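{- A triple $(a,b,c)$ is the first diagonal $(y_{1,0},y_{2,0},y_{3,0})$ of an arithmetic Y-frieze pattern of width $3$ if and only if $(a,b,c)$ is one of $$(1,1,2),(1,2,3),(1,4,5),(2,1,1),(2,3,2),(2,9,5),(3,2,1),(3,8,3),(5,4,1),(5,9,2).$$
   Context: A Y-frieze pattern of width $n$ is an array of rational numbers $y_{i,j}$, $i=0,1,\dots,n+1$, $j\in\mathbb{Z}$, arranged in staggered rows (entry $y_{i,j}$ placed at horizontal position $j+i/2$ in row $i$), such that row $0$ and row $n+1$ consist entirely of $0$'s, no row strictly between them consists entirely of $0$'s, and the Y-diamond rule $WE=(1+N)(1+S)$ holds for every diamond, i.e. $y_{i,j}\,y_{i,j+1}=(1+y_{i-1,j+1})(1+y_{i+1,j})$ for $1\le i\le n$, $j\in\mathbb{Z}$. It is arithmetic if all entries in rows $1,\dots,n$ (its non-zero entries) are positive integers. The first diagonal is $(y_{1,0},y_{2,0},\dots,y_{n,0})$. -}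

module Defs where

open import Data.Nat using (ℕ; zero; suc; _+_; _*_; _<_; _≤_)
open import Data.Integer using (ℤ; +_) renaming (suc to sucℤ)
open import Data.Product using (_×_; Σ; ∃; _,_)
open import Data.Sum using (_⊎_)
open import Relation.Binary.PropositionalEquality using (_≡_)

-- Since an arithmetic frieze has all entries of rows 1..n
-- positive integers and rows 0 and n+1 zero, natural-number entries suffice.
record ArithYFrieze (n : ℕ) : Set where
  field
    y        : ℕ → ℤ → ℕ
    row0     : ∀ j → y 0 j ≡ 0
    rowLast  : ∀ j → y (suc n) j ≡ 0
    positive : ∀ i j → 1 ≤ i → i ≤ n → 1 ≤ y i j
    diamond  : ∀ k j → k < n →
               y (suc k) j * y (suc k) (sucℤ j)
                 ≡ (1 + y k (sucℤ j)) * (1 + y (suc (suc k)) j)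

open ArithYFrieze public

IsFirstDiagonal3 : ℕ → ℕ → ℕ → Set
IsFirstDiagonal3 a b c =
  Σ (ArithYFrieze 3) λ F →
    (y F 1 (+ 0) ≡ a) × (y F 2 (+ 0) ≡ b) × (y F 3 (+ 0) ≡ c)

-- In a frieze of width 3 with rows u, v, w, the diamonds at the two outer rows give
-- v_j + 1 = u_j u_{j+1} = w_{j-1} w_j, and the middle diamond gives
-- v_j v_{j+1} = (1 + u_{j+1}) (1 + w_j).  Let M be the larger of u_{j+1} and w_j.
-- Both v_j + 1 and v_{j+1} + 1 are then multiples of M, while v_j v_{j+1} ≤ (1 + M)²;
-- a multiple is either M itself or at least 2M, and each combination is impossible
-- once M ≥ 6.  Hence all entries of the outer rows are at most 5, and a finite search
-- over (u₀, u₁, u₂, w₀), with w₀ dividing both u₀u₁ and u₁u₂, leaves the ten triples.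
-- Conversely the ten triples form four orbits of the shift j ↦ j + 1, and each orbit
-- is the column sequence of a 3-periodic frieze.
module Submission where

open import Defs
open import Data.Nat using (ℕ; zero; suc; _+_; _*_; _∸_; _≤_; _<_; s≤s; s≤s⁻¹; z<s; _≟_; _≤?_)
open import Data.Nat.Properties
open import Data.Nat.Divisibility using (_∣_; _∣?_; n∣m*n; m∣m*n)
open import Data.Nat.Tactic.RingSolver using (solve-∀)
open import Data.Integer using (ℤ; +_; -[1+_]) renaming (suc to sucℤ)
open import Data.Empty using (⊥; ⊥-elim)
open import Data.Product using (_×_; _,_; proj₁; proj₂)
open import Data.Sum using (_⊎_; inj₁; inj₂)
open import Function.Bundles using (_⇔_; mk⇔)
open import Relation.Nullary.Decidable using (Dec; yes; no; True; toWitness; from-yes; _×-dec_; _⊎-dec_; _→-dec_)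
open import Relation.Binary.PropositionalEquality using (_≡_; _≢_; refl; sym; trans; cong; subst; subst₂; module ≡-Reasoning)

nonzero-multiple-cases : ∀ α {n k} → suc k ≡ α * n → suc k ≡ n ⊎ n + n ≤ suc k
nonzero-multiple-cases 1 {n} e = inj₁ (trans e (*-identityˡ n))
nonzero-multiple-cases (suc (suc α)) {n} e =
  inj₂ (≤-trans (+-monoʳ-≤ n (m≤m+n n (α * n))) (≤-reflexive (sym e)))

between-consecutive-multiples⇒not-multiple :
  ∀ {a k n} c → a * k < n → n < a * suc k → n ≢ a * c
between-consecutive-multiples⇒not-multiple {a} {k} c ak<n n<a[1+k] n≡ac with c ≤? k
... | yes c≤k = <⇒≱ ak<n (≤-trans (≤-reflexive n≡ac) (*-monoʳ-≤ a c≤k))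
... | no c≰k  = <⇒≱ n<a[1+k] (≤-trans (*-monoʳ-≤ a (≰⇒> c≰k)) (≤-reflexive (sym n≡ac)))

multiple-cases⇒≥ : ∀ {n k} → k ≡ n ⊎ n + n ≤ k → n ≤ k
multiple-cases⇒≥ (inj₁ refl) = ≤-refl
multiple-cases⇒≥ {n} (inj₂ n+n≤k) = ≤-trans (m≤m+n n n) n+n≤k

≡*suc⇒≤*suc : ∀ a {z γ k} → z ≡ a * suc γ → γ ≤ k → z ≤ a * suc k
≡*suc⇒≤*suc a z≡ γ≤k = ≤-trans (≤-reflexive z≡) (*-monoʳ-≤ a (s≤s γ≤k))

+-suc⇒< : ∀ a d {b} → a + suc d ≡ b → a < b
+-suc⇒< a d e = ≤-trans (m<m+n a z<s) (≤-reflexive e)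

large-product : ∀ m {X Y} → (5 + m) + (6 + m) ≤ X → 5 + m ≤ Y → (7 + m) * (7 + m) < X * Y
large-product m X≥ Y≥ =
  <-≤-trans (+-suc⇒< _ (5 + 7 * m + m * m) (expand m)) (*-mono-≤ X≥ Y≥)
  where
  expand : ∀ m → (7 + m) * (7 + m) + suc (5 + 7 * m + m * m) ≡ (5 + m + (6 + m)) * (5 + m)
  expand = solve-∀

-- The case M = 6 + m of peak≤5, with X + 1 and Y + 1 as given by nonzero-multiple-cases.
no-peak-above-5 : ∀ m {X Y γ} →
  suc X ≡ 6 + m ⊎ (6 + m) + (6 + m) ≤ suc X →
  suc Y ≡ 6 + m ⊎ (6 + m) + (6 + m) ≤ suc Y →
  X * Y ≡ (7 + m) * (1 + γ) → γ ≤ 6 + m → ⊥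
no-peak-above-5 m {γ = γ} (inj₁ refl) (inj₁ refl) XY≡ _ =
  between-consecutive-multiples⇒not-multiple {7 + m} {3 + m} (1 + γ)
    (+-suc⇒< _ 3 (below m)) (+-suc⇒< _ (2 + m) (above m)) XY≡
  where
  below : ∀ m → (7 + m) * (3 + m) + 4 ≡ (5 + m) * (5 + m)
  below = solve-∀
  above : ∀ m → (5 + m) * (5 + m) + (3 + m) ≡ (7 + m) * (4 + m)
  above = solve-∀
no-peak-above-5 m (inj₂ X-large) Y-cases XY≡ γ≤ =
  <⇒≱ (large-product m (s≤s⁻¹ X-large) (s≤s⁻¹ (multiple-cases⇒≥ Y-cases)))
      (≡*suc⇒≤*suc (7 + m) XY≡ γ≤)
no-peak-above-5 m {X} {Y} X-cases@(inj₁ _) (inj₂ Y-large) XY≡ γ≤ =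
  <⇒≱ (large-product m (s≤s⁻¹ Y-large) (s≤s⁻¹ (multiple-cases⇒≥ X-cases)))
      (≡*suc⇒≤*suc (7 + m) (trans (*-comm Y X) XY≡) γ≤)

peak≤5 : ∀ {M α β γ X Y} → suc X ≡ α * M → suc Y ≡ M * β →
  X * Y ≡ (1 + M) * (1 + γ) → γ ≤ M → M ≤ 5
peak≤5 {M} {α} {β} X+1≡ Y+1≡ XY≡ γ≤M with M ≤? 5
... | yes M≤5 = M≤5
... | no M≰5 with m≤n⇒∃[o]m+o≡n (≰⇒> M≰5)
...   | m , refl = ⊥-elim (no-peak-above-5 m
          (nonzero-multiple-cases α X+1≡)
          (nonzero-multiple-cases β (trans Y+1≡ (*-comm M β)))
          XY≡ γ≤M)

ListedTriple : ℕ → ℕ → ℕ → Set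
ListedTriple a b c =
  (a ≡ 1 × b ≡ 1 × c ≡ 2) ⊎ (a ≡ 1 × b ≡ 2 × c ≡ 3) ⊎ (a ≡ 1 × b ≡ 4 × c ≡ 5)
  ⊎ (a ≡ 2 × b ≡ 1 × c ≡ 1) ⊎ (a ≡ 2 × b ≡ 3 × c ≡ 2) ⊎ (a ≡ 2 × b ≡ 9 × c ≡ 5)
  ⊎ (a ≡ 3 × b ≡ 2 × c ≡ 1) ⊎ (a ≡ 3 × b ≡ 8 × c ≡ 3) ⊎ (a ≡ 5 × b ≡ 4 × c ≡ 1)
  ⊎ (a ≡ 5 × b ≡ 9 × c ≡ 2)

listed? : ∀ a b c → Dec (ListedTriple a b c)
listed? a b c =
  triple? 1 1 2 ⊎-dec triple? 1 2 3 ⊎-dec triple? 1 4 5 ⊎-dec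
  triple? 2 1 1 ⊎-dec triple? 2 3 2 ⊎-dec triple? 2 9 5 ⊎-dec
  triple? 3 2 1 ⊎-dec triple? 3 8 3 ⊎-dec triple? 5 4 1 ⊎-dec triple? 5 9 2
  where
  triple? : ∀ x y z → Dec (a ≡ x × b ≡ y × c ≡ z)
  triple? x y z = (a ≟ x) ×-dec (b ≟ y) ×-dec (c ≟ z)

bounded-diagonal-search :
  ∀ {u₀} → u₀ < 6 → ∀ {u₁} → u₁ < 6 → ∀ {u₂} → u₂ < 6 → ∀ {w₀} → w₀ < 6 →
  w₀ ∣ u₀ * u₁ → w₀ ∣ u₁ * u₂ → (u₀ * u₁ ∸ 1) * (u₁ * u₂ ∸ 1) ≡ (1 + u₁) * (1 + w₀) →
  ListedTriple u₀ (u₀ * u₁ ∸ 1) w₀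
bounded-diagonal-search = from-yes
  (allUpTo? (λ u₀ → allUpTo? (λ u₁ → allUpTo? (λ u₂ → allUpTo? (λ w₀ →
     w₀ ∣? u₀ * u₁ →-dec w₀ ∣? u₁ * u₂ →-dec
     (u₀ * u₁ ∸ 1) * (u₁ * u₂ ∸ 1) ≟ (1 + u₁) * (1 + w₀) →-dec
     listed? u₀ (u₀ * u₁ ∸ 1) w₀) 6) 6) 6) 6)

module _ (F : ArithYFrieze 3) where
  open ≡-Reasoning
  private
    u v w : ℤ → ℕ
    u = y F 1
    v = y F 2
    w = y F 3

  top-diamond : ∀ j → suc (v j) ≡ u j * u (sucℤ j)
  top-diamond j = sym (begin
    u j * u (sucℤ j)                  ≡⟨ diamond F 0 j z<s ⟩
    (1 + y F 0 (sucℤ j)) * (1 + v j)  ≡⟨ cong (λ t → (1 + t) * (1 + v j)) (row0 F (sucℤ j)) ⟩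
    1 * (1 + v j)                     ≡⟨ *-identityˡ (1 + v j) ⟩
    suc (v j)                         ∎)

  bottom-diamond : ∀ j → suc (v (sucℤ j)) ≡ w j * w (sucℤ j)
  bottom-diamond j = sym (begin
    w j * w (sucℤ j)                  ≡⟨ diamond F 2 j (s≤s (s≤s z<s)) ⟩
    (1 + v (sucℤ j)) * (1 + y F 4 j)  ≡⟨ cong (λ t → (1 + v (sucℤ j)) * (1 + t)) (rowLast F j) ⟩
    (1 + v (sucℤ j)) * 1              ≡⟨ *-identityʳ (1 + v (sucℤ j)) ⟩
    suc (v (sucℤ j))                  ∎)

  top≡bottom : ∀ j → u (sucℤ j) * u (sucℤ (sucℤ j)) ≡ w j * w (sucℤ j)
  top≡bottom j = trans (sym (top-diamond (sucℤ j))) (bottom-diamond j)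

  v≡u*u∸1 : ∀ j → v j ≡ u j * u (sucℤ j) ∸ 1
  v≡u*u∸1 j = cong (_∸ 1) (top-diamond j)

  middle-diamond : ∀ j → v j * v (sucℤ j) ≡ (1 + u (sucℤ j)) * (1 + w j)
  middle-diamond j = diamond F 1 j (s≤s z<s)

  outer-rows≤5 : ∀ j → u (sucℤ (sucℤ j)) ≤ 5 × w (sucℤ j) ≤ 5
  outer-rows≤5 j with ≤-total (u (sucℤ (sucℤ j))) (w (sucℤ j))
  ... | inj₁ u≤w = ≤-trans u≤w w≤5 , w≤5
    where
    w≤5 : w (sucℤ j) ≤ 5
    w≤5 = peak≤5 {α = w j} {β = w (sucℤ (sucℤ j))}
            (bottom-diamond j) (bottom-diamond (sucℤ j))
            (trans (middle-diamond (sucℤ j)) (*-comm (1 + u (sucℤ (sucℤ j))) _)) u≤w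
  ... | inj₂ w≤u = u≤5 , ≤-trans w≤u u≤5
    where
    u≤5 : u (sucℤ (sucℤ j)) ≤ 5
    u≤5 = peak≤5 {α = u (sucℤ j)} {β = u (sucℤ (sucℤ (sucℤ j)))}
            (top-diamond (sucℤ j)) (top-diamond (sucℤ (sucℤ j)))
            (middle-diamond (sucℤ j)) w≤u

  first-diagonal-listed : ListedTriple (u (+ 0)) (v (+ 0)) (w (+ 0))
  first-diagonal-listed = subst (λ b → ListedTriple (u (+ 0)) b (w (+ 0))) (sym (v≡u*u∸1 (+ 0)))
    (bounded-diagonal-search
      (s≤s (proj₁ (outer-rows≤5 -[1+ 1 ]))) (s≤s (proj₁ (outer-rows≤5 -[1+ 0 ])))
      (s≤s (proj₁ (outer-rows≤5 (+ 0)))) (s≤s (proj₂ (outer-rows≤5 -[1+ 0 ])))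
      (subst (w (+ 0) ∣_) (sym (top≡bottom -[1+ 0 ])) (n∣m*n (w -[1+ 0 ])))
      (subst (w (+ 0) ∣_) (sym (top≡bottom (+ 0))) (m∣m*n (w (+ 1))))
      (subst₂ (λ a b → a * b ≡ (1 + u (+ 1)) * (1 + w (+ 0)))
        (v≡u*u∸1 (+ 0)) (v≡u*u∸1 (+ 1)) (middle-diamond (+ 0))))

Column : Set
Column = ℕ × ℕ × ℕ

entry : ℕ → Column → ℕ
entry 1 (a , _ , _) = a
entry 2 (_ , b , _) = b
entry 3 (_ , _ , c) = c
entry _ _           = 0

PositiveColumn : Column → Set
PositiveColumn x = ∀ {k} → k < 3 → 1 ≤ entry (suc k) x

DiamondRule : Column → Column → Set
DiamondRule x x′ = ∀ {k} → k < 3 →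
  entry (suc k) x * entry (suc k) x′ ≡ (1 + entry k x′) * (1 + entry (suc (suc k)) x)

Adjacent : Column → Column → Set
Adjacent x x′ = PositiveColumn x × DiamondRule x x′

adjacent? : ∀ x x′ → Dec (Adjacent x x′)
adjacent? x x′ =
  allUpTo? (λ k → 1 ≤? entry (suc k) x) 3 ×-dec
  allUpTo? (λ k → entry (suc k) x * entry (suc k) x′
                    ≟ (1 + entry k x′) * (1 + entry (suc (suc k)) x)) 3

frieze-from-columns : (col : ℤ → Column) →
  (∀ j → Adjacent (col j) (col (sucℤ j))) → ArithYFrieze 3
frieze-from-columns col adjacent = record
  { y        = λ i j → entry i (col j)
  ; row0     = λ _ → refl
  ; rowLast  = λ _ → refl
  ; positive = λ { (suc i) j _ i<3 → proj₁ (adjacent j) i<3 }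
  ; diamond  = λ k j k<3 → proj₂ (adjacent j) k<3
  }

periodic : Column → Column → Column → ℤ → Column
periodic x₀ x₁ x₂ (+ zero)     = x₀
periodic x₀ x₁ x₂ (+ suc n)    = periodic x₁ x₂ x₀ (+ n)
periodic x₀ x₁ x₂ -[1+ zero ]  = x₂
periodic x₀ x₁ x₂ -[1+ suc n ] = periodic x₂ x₀ x₁ -[1+ n ]

periodic-suc : ∀ x₀ x₁ x₂ j → periodic x₀ x₁ x₂ (sucℤ j) ≡ periodic x₁ x₂ x₀ j
periodic-suc x₀ x₁ x₂ (+ n)          = refl
periodic-suc x₀ x₁ x₂ -[1+ zero ]    = refl
periodic-suc x₀ x₁ x₂ -[1+ suc n ]   = refl

periodic-preserves : (R : Column → Column → Set) →
  ∀ {x₀ x₁ x₂} → R x₀ x₁ → R x₁ x₂ → R x₂ x₀ →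
  ∀ j → R (periodic x₀ x₁ x₂ j) (periodic x₀ x₁ x₂ (sucℤ j))
periodic-preserves R r₀₁ r₁₂ r₂₀ (+ zero)    = r₀₁
periodic-preserves R r₀₁ r₁₂ r₂₀ (+ suc n)   = periodic-preserves R r₁₂ r₂₀ r₀₁ (+ n)
periodic-preserves R r₀₁ r₁₂ r₂₀ -[1+ zero ] = r₂₀
periodic-preserves R {x₀} {x₁} {x₂} r₀₁ r₁₂ r₂₀ -[1+ suc n ] =
  subst (R (periodic x₂ x₀ x₁ -[1+ n ])) (periodic-suc x₂ x₀ x₁ -[1+ n ])
    (periodic-preserves R r₂₀ r₀₁ r₁₂ -[1+ n ])

cycle⇒first-diagonal : ∀ {a b c} x₁ x₂ →
  {True (adjacent? (a , b , c) x₁ ×-dec adjacent? x₁ x₂ ×-dec adjacent? x₂ (a , b , c))} →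
  IsFirstDiagonal3 a b c
cycle⇒first-diagonal {a} {b} {c} x₁ x₂ {ok} =
  let r₀₁ , r₁₂ , r₂₀ = toWitness ok in
  frieze-from-columns (periodic (a , b , c) x₁ x₂) (periodic-preserves Adjacent r₀₁ r₁₂ r₂₀) ,
  refl , refl , refl

listed⇒first-diagonal : ∀ {a b c} → ListedTriple a b c → IsFirstDiagonal3 a b c
listed⇒first-diagonal (inj₁ (refl , refl , refl)) =
  cycle⇒first-diagonal (2 , 9 , 5) (5 , 4 , 1)
listed⇒first-diagonal (inj₂ (inj₁ (refl , refl , refl))) =
  cycle⇒first-diagonal (3 , 8 , 3) (3 , 2 , 1)
listed⇒first-diagonal (inj₂ (inj₂ (inj₁ (refl , refl , refl)))) =
  cycle⇒first-diagonal (5 , 9 , 2) (2 , 1 , 1)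
listed⇒first-diagonal (inj₂ (inj₂ (inj₂ (inj₁ (refl , refl , refl))))) =
  cycle⇒first-diagonal (1 , 4 , 5) (5 , 9 , 2)
listed⇒first-diagonal (inj₂ (inj₂ (inj₂ (inj₂ (inj₁ (refl , refl , refl)))))) =
  cycle⇒first-diagonal (2 , 3 , 2) (2 , 3 , 2)
listed⇒first-diagonal (inj₂ (inj₂ (inj₂ (inj₂ (inj₂ (inj₁ (refl , refl , refl))))))) =
  cycle⇒first-diagonal (5 , 4 , 1) (1 , 1 , 2)
listed⇒first-diagonal (inj₂ (inj₂ (inj₂ (inj₂ (inj₂ (inj₂ (inj₁ (refl , refl , refl)))))))) =
  cycle⇒first-diagonal (1 , 2 , 3) (3 , 8 , 3)
listed⇒first-diagonal (inj₂ (inj₂ (inj₂ (inj₂ (inj₂ (inj₂ (inj₂ (inj₁ (refl , refl , refl))))))))) =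
  cycle⇒first-diagonal (3 , 2 , 1) (1 , 2 , 3)
listed⇒first-diagonal (inj₂ (inj₂ (inj₂ (inj₂ (inj₂ (inj₂ (inj₂ (inj₂ (inj₁ (refl , refl , refl)))))))))) =
  cycle⇒first-diagonal (1 , 1 , 2) (2 , 9 , 5)
listed⇒first-diagonal (inj₂ (inj₂ (inj₂ (inj₂ (inj₂ (inj₂ (inj₂ (inj₂ (inj₂ (refl , refl , refl)))))))))) =
  cycle⇒first-diagonal (2 , 1 , 1) (1 , 4 , 5)

first-diagonal⇒listed : ∀ {a b c} → IsFirstDiagonal3 a b c → ListedTriple a b c
first-diagonal⇒listed (F , refl , refl , refl) = first-diagonal-listed F

theorem2p4 : (a b c : ℕ) →
    IsFirstDiagonal3 a b c ⇔
      ((a ≡ 1 × b ≡ 1 × c ≡ 2) ⊎ (a ≡ 1 × b ≡ 2 × c ≡ 3) ⊎ (a ≡ 1 × b ≡ 4 × c ≡ 5)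
       ⊎ (a ≡ 2 × b ≡ 1 × c ≡ 1) ⊎ (a ≡ 2 × b ≡ 3 × c ≡ 2) ⊎ (a ≡ 2 × b ≡ 9 × c ≡ 5)
       ⊎ (a ≡ 3 × b ≡ 2 × c ≡ 1) ⊎ (a ≡ 3 × b ≡ 8 × c ≡ 3) ⊎ (a ≡ 5 × b ≡ 4 × c ≡ 1)
       ⊎ (a ≡ 5 × b ≡ 9 × c ≡ 2))
theorem2p4 a b c = mk⇔ first-diagonal⇒listed listed⇒first-diagonal
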